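{- For every integer $n\ge 3$, $\gamma_I(C_3 \square C_n) = 2n$.
   Context: For an integer $k\ge 2$, $C_k$ denotes the directed cycle with vertex set $\{1,2,\dots,k\}$ and arcs $i\rightarrow i+1$ (indices taken modulo $k$). For digraphs $D_1=(V_1,A_1)$ and $D_2=(V_2,A_2)$, the cartesian product $D_1\square D_2$ is the digraph with vertex set $V_1\times V_2$ in which $(x_1,x_2)\rightarrow(y_1,y_2)$ is an arc if and only if either ($x_1=y_1$ and $x_2\rightarrow y_2$ in $D_2$) or ($x_1\rightarrow y_1$ in $D_1$ and $x_2=y_2$). An Italian dominating function on a digraph $D$ is a function $f:V(D)\to\{0,1,2\}$ such that every vertex $v$ with $f(v)=0$ has at least two in-neighbors $u$ with $f(u)=1$ or at least one in-neighbor $w$ with $f(w)=2$ (an in-neighbor of $v$ is a vertex $u$ with $u\rightarrow v$). Its weight is $\sum_{u\in V(D)} f(u)$, and the Italian domination number $\gamma_I(D)$ is the minimum weight of an Italian dominating function on $D$. -}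

module Defs where

open import Data.Nat using (ℕ; zero; suc; _+_; _*_; _≤_)
open import Data.Fin as Fin using (Fin; toℕ)
open import Data.Product using (_×_; _,_; Σ; ∃-syntax)
open import Data.Sum using (_⊎_)
open import Relation.Binary.PropositionalEquality using (_≡_)

sumFin : (n : ℕ) → (Fin n → ℕ) → ℕ
sumFin zero    f = 0
sumFin (suc n) f = f Fin.zero + sumFin n (λ i → f (Fin.suc i))

record Digraph (V : Set) : Set₁ where
  field
    Arc : V → V → Set

open Digraph public

-- Directed cycle C_k on vertex set Fin k (vertex i ∈ Fin k stands for i+1),
-- arcs i → i+1 taken modulo k.
Cycle : (k : ℕ) → Digraph (Fin k)
Arc (Cycle k) i j = (toℕ j ≡ suc (toℕ i)) ⊎ (suc (toℕ i) ≡ k × toℕ j ≡ 0)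

_□_ : {V₁ V₂ : Set} → Digraph V₁ → Digraph V₂ → Digraph (V₁ × V₂)
Arc (D₁ □ D₂) (x₁ , x₂) (y₁ , y₂) =
  (x₁ ≡ y₁ × Arc D₂ x₂ y₂) ⊎ (Arc D₁ x₁ y₁ × x₂ ≡ y₂)

IsItalianDF : {V : Set} → Digraph V → (V → Fin 3) → Set
IsItalianDF {V} D f =
  (v : V) → toℕ (f v) ≡ 0 →
    (Σ V λ u → Σ V λ w → ¬ (u ≡ w) × Arc D u v × Arc D w v
                        × toℕ (f u) ≡ 1 × toℕ (f w) ≡ 1)
    ⊎ (Σ V λ u → Arc D u v × toℕ (f u) ≡ 2)
  where open import Relation.Nullary using (¬_)

weight : (m n : ℕ) → (Fin m × Fin n → Fin 3) → ℕ
weight m n f = sumFin m λ i → sumFin n λ j → toℕ (f (i , j))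

IsItalianDominationNumber : (m n : ℕ) → ℕ → Set
IsItalianDominationNumber m n g =
  (Σ (Fin m × Fin n → Fin 3) λ f → IsItalianDF (Cycle m □ Cycle n) f × weight m n f ≡ g)
  × ((f : Fin m × Fin n → Fin 3) → IsItalianDF (Cycle m □ Cycle n) f → g ≤ weight m n f)

-- In C₃ □ Cₙ the in-neighbours of (i , j) are (i − 1 , j) and (i , j − 1), so the Italian
-- condition is local to a column and its predecessor.  If column j has weight c < 2, the
-- condition on its three vertices forces column j − 1 to have weight at least 4 − c.  Hence
-- if every column hands its deficit 2 ∸ c to its predecessor, each column still carries at
-- least 2, and the total weight is at least 2n.  Conversely, put a 0 at (z j , j) and 1s
-- elsewhere in column j, where z is a colouring of Cₙ with z (j − 1) ≠ z j: that 0 is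
-- dominated by the 1s at (z j − 1 , j) and (z j , j − 1), and the weight is exactly 2n.

module Submission where

open import Defs
open import Data.Nat using (ℕ; zero; suc; _+_; _*_; _∸_; _≤_; _≤?_; z≤n; s≤s)
open import Data.Nat.Properties
  using (+-0-commutativeMonoid; +-comm; +-mono-≤; +-cancelʳ-≤; *-comm; *-identityʳ; suc-injective; 1+n≢n)
  renaming (_≟_ to _≟ℕ_)
open import Data.Fin using (Fin; toℕ; fromℕ; inject₁)
open import Data.Fin.Patterns using (0F; 1F; 2F)
open import Data.Fin.Properties using (toℕ-injective; toℕ-fromℕ; toℕ-inject₁; all?)
open import Data.Vec.Functional using (_∷_; [])
open import Data.Product using (_×_; _,_; proj₁)
open import Data.Sum using (_⊎_; inj₁; inj₂)
open import Data.Empty using (⊥-elim)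
open import Function using (_∘_)
open import Relation.Nullary.Decidable using (Dec; _→-dec_; _×-dec_; _⊎-dec_; toWitness)
open import Relation.Binary.PropositionalEquality
open import Algebra.Properties.CommutativeMonoid.Sum +-0-commutativeMonoid
  using (sum; sum-syntax; sum-cong-≗; sum-init-last; ∑-comm; ∑-distrib-+)

sumFin≡sum : ∀ n (t : Fin n → ℕ) → sumFin n t ≡ sum t
sumFin≡sum zero    t = refl
sumFin≡sum (suc n) t = cong (t 0F +_) (sumFin≡sum n (t ∘ Fin.suc))

weight≡∑-columns : ∀ m n f → weight m n f ≡ ∑[ j < n ] ∑[ i < m ] toℕ (f (i , j))
weight≡∑-columns m n f = begin
  weight m n f                                ≡⟨ sumFin≡sum m _ ⟩
  sum (λ i → sumFin n λ j → toℕ (f (i , j)))  ≡⟨ sum-cong-≗ (λ i → sumFin≡sum n λ j → toℕ (f (i , j))) ⟩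
  ∑[ i < m ] ∑[ j < n ] toℕ (f (i , j))       ≡⟨ ∑-comm (λ i j → toℕ (f (i , j))) ⟩
  ∑[ j < n ] ∑[ i < m ] toℕ (f (i , j))       ∎
  where open ≡-Reasoning

sum-const : ∀ n k → ∑[ i < n ] k ≡ n * k
sum-const zero    k = refl
sum-const (suc n) k = cong (k +_) (sum-const n k)

sum-mono-≤ : ∀ {n} {s t : Fin n → ℕ} → (∀ i → s i ≤ t i) → sum s ≤ sum t
sum-mono-≤ {zero}  s≤t = z≤n
sum-mono-≤ {suc n} s≤t = +-mono-≤ (s≤t 0F) (sum-mono-≤ (s≤t ∘ Fin.suc))

prev : ∀ {n} → Fin (suc n) → Fin (suc n)
prev {n} Fin.zero = fromℕ n
prev (Fin.suc i) = inject₁ i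

prev≢id : ∀ {m} (i : Fin (suc (suc m))) → prev i ≢ i
prev≢id (Fin.suc i) inject₁i≡1+i =
  1+n≢n (trans (sym (cong toℕ inject₁i≡1+i)) (toℕ-inject₁ i))

sum-prev : ∀ {n} (t : Fin (suc n) → ℕ) → sum (t ∘ prev) ≡ sum t
sum-prev {n} t = trans (+-comm (t (fromℕ n)) (sum (t ∘ inject₁))) (sym (sum-init-last t))

Cycle-arc⇒≡prev : ∀ {n} {i j : Fin (suc n)} → Arc (Cycle (suc n)) i j → i ≡ prev j
Cycle-arc⇒≡prev {n} {j = Fin.zero} (inj₂ (i+1≡n+1 , _)) =
  toℕ-injective (trans (suc-injective i+1≡n+1) (sym (toℕ-fromℕ n)))
Cycle-arc⇒≡prev {j = Fin.suc j} (inj₁ j+1≡i+1) =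
  toℕ-injective (trans (sym (suc-injective j+1≡i+1)) (sym (toℕ-inject₁ j)))

prev-arc : ∀ {n} (j : Fin (suc n)) → Arc (Cycle (suc n)) (prev j) j
prev-arc {n} Fin.zero = inj₂ (cong suc (toℕ-fromℕ n) , refl)
prev-arc (Fin.suc j) = inj₁ (cong suc (sym (toℕ-inject₁ j)))

□-inNeighbour : ∀ {m n} {u} {i : Fin (suc m)} {j : Fin (suc n)} →
  Arc (Cycle (suc m) □ Cycle (suc n)) u (i , j) → u ≡ (prev i , j) ⊎ u ≡ (i , prev j)
□-inNeighbour (inj₁ (refl , arc)) = inj₂ (cong (_ ,_) (Cycle-arc⇒≡prev arc))
□-inNeighbour (inj₂ (arc , refl)) = inj₁ (cong (_, _) (Cycle-arc⇒≡prev arc))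

ItalianDominatedBy : (x u w : Fin 3) → Set
ItalianDominatedBy x u w = toℕ x ≡ 0 → (toℕ u ≡ 1 × toℕ w ≡ 1) ⊎ (toℕ u ≡ 2 ⊎ toℕ w ≡ 2)

italianDominatedBy? : ∀ x u w → Dec (ItalianDominatedBy x u w)
italianDominatedBy? x u w =
  toℕ x ≟ℕ 0 →-dec ((toℕ u ≟ℕ 1 ×-dec toℕ w ≟ℕ 1) ⊎-dec (toℕ u ≟ℕ 2 ⊎-dec toℕ w ≟ℕ 2))

module _ {m n} (f : Fin (suc m) × Fin (suc n) → Fin 3) where

  IsItalianDF⇒dominatedBy-inNeighbours : IsItalianDF (Cycle (suc m) □ Cycle (suc n)) f →
    ∀ i j → ItalianDominatedBy (f (i , j)) (f (prev i , j)) (f (i , prev j))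
  IsItalianDF⇒dominatedBy-inNeighbours italian i j fij≡0 with italian (i , j) fij≡0
  ... | inj₂ (u , arc , fu≡2) with □-inNeighbour arc
  ...   | inj₁ refl = inj₂ (inj₁ fu≡2)
  ...   | inj₂ refl = inj₂ (inj₂ fu≡2)
  IsItalianDF⇒dominatedBy-inNeighbours italian i j fij≡0
    | inj₁ (u , w , u≢w , u-arc , w-arc , fu≡1 , fw≡1) with □-inNeighbour u-arc | □-inNeighbour w-arc
  ... | inj₁ refl | inj₁ refl = ⊥-elim (u≢w refl)
  ... | inj₁ refl | inj₂ refl = inj₁ (fu≡1 , fw≡1)
  ... | inj₂ refl | inj₁ refl = inj₁ (fw≡1 , fu≡1)
  ... | inj₂ refl | inj₂ refl = ⊥-elim (u≢w refl)

  dominatedBy-inNeighbours⇒IsItalianDF : (∀ i → prev i ≢ i) →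
    (∀ i j → ItalianDominatedBy (f (i , j)) (f (prev i , j)) (f (i , prev j))) →
    IsItalianDF (Cycle (suc m) □ Cycle (suc n)) f
  dominatedBy-inNeighbours⇒IsItalianDF prev≢id dominated (i , j) fij≡0 with dominated i j fij≡0
  ... | inj₁ (fu≡1 , fw≡1) =
    inj₁ (_ , _ , prev≢id i ∘ cong proj₁ , inj₂ (prev-arc i , refl) , inj₁ (refl , prev-arc j) , fu≡1 , fw≡1)
  ... | inj₂ (inj₁ fu≡2) = inj₂ (_ , inj₂ (prev-arc i , refl) , fu≡2)
  ... | inj₂ (inj₂ fw≡2) = inj₂ (_ , inj₁ (refl , prev-arc j) , fw≡2)

discharge : ∀ {n} k (c d : Fin (suc n) → ℕ) →
  (∀ j → k + d j ≤ c (prev j) + d (prev j)) → suc n * k ≤ sum c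
discharge {n} k c d local = +-cancelʳ-≤ (sum d) _ _ (subst₂ _≤_ lhs rhs (sum-mono-≤ local))
  where
  lhs : ∑[ j < suc n ] (k + d j) ≡ suc n * k + sum d
  lhs = trans (∑-distrib-+ (λ _ → k) d) (cong (_+ sum d) (sum-const (suc n) k))
  rhs : ∑[ j < suc n ] (c (prev j) + d (prev j)) ≡ sum c + sum d
  rhs = trans (∑-distrib-+ (c ∘ prev) (d ∘ prev)) (cong₂ _+_ (sum-prev c) (sum-prev d))

deficit : ℕ → ℕ
deficit c = 2 ∸ c

columnWeight : (Fin 3 → Fin 3) → ℕ
columnWeight a = ∑[ i < 3 ] toℕ (a i)

ColumnDischarges : (a b : Fin 3 → Fin 3) → Set
ColumnDischarges a b = (∀ i → ItalianDominatedBy (a i) (a (prev i)) (b i)) →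
  2 + deficit (columnWeight a) ≤ columnWeight b + deficit (columnWeight b)

-- A column of weight c < 2 forces weight at least 4 ∸ c on the column before it;
-- checked over all 3⁶ pairs of columns.
column-discharges : ∀ a b → ColumnDischarges a b
column-discharges a b dominated =
  table (a 0F) (a 1F) (a 2F) (b 0F) (b 1F) (b 2F)
    λ { 0F → dominated 0F ; 1F → dominated 1F ; 2F → dominated 2F }
  where
  table : ∀ a₀ a₁ a₂ b₀ b₁ b₂ → ColumnDischarges (a₀ ∷ a₁ ∷ a₂ ∷ []) (b₀ ∷ b₁ ∷ b₂ ∷ [])
  table = toWitness {a? = all? λ a₀ → all? λ a₁ → all? λ a₂ → all? λ b₀ → all? λ b₁ → all? λ b₂ →
    let a = a₀ ∷ a₁ ∷ a₂ ∷ [] ; b = b₀ ∷ b₁ ∷ b₂ ∷ [] in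
    (all? λ i → italianDominatedBy? (a i) (a (prev i)) (b i))
      →-dec (2 + deficit (columnWeight a) ≤? columnWeight b + deficit (columnWeight b))} _

lowerBound : ∀ {n} (f : Fin 3 × Fin (suc n) → Fin 3) → IsItalianDF (Cycle 3 □ Cycle (suc n)) f →
  2 * suc n ≤ weight 3 (suc n) f
lowerBound {n} f italian = subst₂ _≤_ (*-comm (suc n) 2) (sym (weight≡∑-columns 3 (suc n) f))
  (discharge 2 (columnWeight ∘ column) (deficit ∘ columnWeight ∘ column)
    λ j → column-discharges (column j) (column (prev j))
            λ i → IsItalianDF⇒dominatedBy-inNeighbours f italian i j)
  where
  column : Fin (suc n) → Fin 3 → Fin 3
  column j i = f (i , j)

onesExcept : ∀ {m} → Fin m → Fin m → Fin 3
onesExcept Fin.zero    Fin.zero    = 0F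
onesExcept (Fin.suc w) (Fin.suc i) = onesExcept w i
onesExcept _           _           = 1F

onesExcept≡0⇒≡ : ∀ {m} (w i : Fin m) → toℕ (onesExcept w i) ≡ 0 → i ≡ w
onesExcept≡0⇒≡ Fin.zero    Fin.zero    _ = refl
onesExcept≡0⇒≡ (Fin.suc w) (Fin.suc i) e = cong Fin.suc (onesExcept≡0⇒≡ w i e)

onesExcept≢ : ∀ {m} (w i : Fin m) → i ≢ w → toℕ (onesExcept w i) ≡ 1
onesExcept≢ Fin.zero    Fin.zero    i≢w = ⊥-elim (i≢w refl)
onesExcept≢ Fin.zero    (Fin.suc i) i≢w = refl
onesExcept≢ (Fin.suc w) Fin.zero    i≢w = refl
onesExcept≢ (Fin.suc w) (Fin.suc i) i≢w = onesExcept≢ w i (i≢w ∘ cong Fin.suc)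

sum-onesExcept : ∀ {m} (w : Fin (suc m)) → ∑[ i < suc m ] toℕ (onesExcept w i) ≡ m
sum-onesExcept {m} Fin.zero = trans (sum-const m 1) (*-identityʳ m)
sum-onesExcept {suc m} (Fin.suc w) = cong suc (sum-onesExcept w)

fromColouring : ∀ {m n} → (Fin n → Fin m) → Fin m × Fin n → Fin 3
fromColouring z (i , j) = onesExcept (z j) i

fromColouring-italian : ∀ {m n} (z : Fin (suc n) → Fin (suc (suc m))) → (∀ j → z (prev j) ≢ z j) →
  IsItalianDF (Cycle (suc (suc m)) □ Cycle (suc n)) (fromColouring z)
fromColouring-italian z proper =
  dominatedBy-inNeighbours⇒IsItalianDF (fromColouring z) prev≢id dominated
  where
  dominated : ∀ i j →
    ItalianDominatedBy (onesExcept (z j) i) (onesExcept (z j) (prev i)) (onesExcept (z (prev j)) i)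
  dominated i j zero-at-ij with onesExcept≡0⇒≡ (z j) i zero-at-ij
  ... | refl = inj₁ (onesExcept≢ (z j) (prev i) (prev≢id i) , onesExcept≢ (z (prev j)) i (proper j ∘ sym))

weight-fromColouring : ∀ {m n} (z : Fin n → Fin (suc m)) → weight (suc m) n (fromColouring z) ≡ n * m
weight-fromColouring {m} {n} z = begin
  weight (suc m) n (fromColouring z)                  ≡⟨ weight≡∑-columns (suc m) n (fromColouring z) ⟩
  ∑[ j < n ] ∑[ i < suc m ] toℕ (onesExcept (z j) i)  ≡⟨ sum-cong-≗ (sum-onesExcept ∘ z) ⟩
  ∑[ j < n ] m                                        ≡⟨ sum-const n m ⟩
  n * m                                               ∎
  where open ≡-Reasoning

swap02 : Fin 3 → Fin 3
swap02 0F = 2F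
swap02 1F = 1F
swap02 2F = 0F

swap02-involutive : ∀ x → swap02 (swap02 x) ≡ x
swap02-involutive 0F = refl
swap02-involutive 1F = refl
swap02-involutive 2F = refl

swap02-injective : ∀ {x y} → swap02 x ≡ swap02 y → x ≡ y
swap02-injective {x} {y} swapx≡swapy =
  trans (sym (swap02-involutive x)) (trans (cong swap02 swapx≡swapy) (swap02-involutive y))

cycleColouring : ∀ {n} → Fin (suc n) → Fin 3
cycleColouring {zero}  0F          = 1F
cycleColouring {suc n} Fin.zero    = 2F
cycleColouring {suc n} (Fin.suc j) = swap02 (cycleColouring j)

cycleColouring-last : ∀ n → cycleColouring (fromℕ n) ≡ 1F
cycleColouring-last zero    = refl
cycleColouring-last (suc n) = cong swap02 (cycleColouring-last n)

cycleColouring-inject₁≢suc : ∀ {n} (j : Fin (suc n)) →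
  cycleColouring (inject₁ j) ≢ cycleColouring (Fin.suc j)
cycleColouring-inject₁≢suc {zero}  Fin.zero ()
cycleColouring-inject₁≢suc {suc n} Fin.zero ()
cycleColouring-inject₁≢suc {suc n} (Fin.suc j) = cycleColouring-inject₁≢suc j ∘ swap02-injective

cycleColouring-proper : ∀ {n} (j : Fin (suc (suc n))) → cycleColouring (prev j) ≢ cycleColouring j
cycleColouring-proper {n} Fin.zero colours≡ with () ← trans (sym (cycleColouring-last (suc n))) colours≡
cycleColouring-proper (Fin.suc j) = cycleColouring-inject₁≢suc j

theorem2p3 : (n : ℕ) → 3 ≤ n → IsItalianDominationNumber 3 n (2 * n)
theorem2p3 n (s≤s (s≤s (s≤s _))) =
  ( fromColouring cycleColouring
  , fromColouring-italian cycleColouring cycleColouring-proper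
  , trans (weight-fromColouring {n = n} cycleColouring) (*-comm n 2) )
  , lowerBound
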